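{- The simple permutations in $\operatorname{Av}(2143,3142,263514)$ are exactly the simple permutations in $\operatorname{Av}(2143,3142,4132)$; i.e., $\operatorname{Si}(\operatorname{Av}(2143,3142,263514))=\operatorname{Si}(\operatorname{Av}(2143,3142,4132))$.
   Context: For $i\le j$, a set of consecutive positions $[i,j]=\{i,\dots,j\}$ is an interval of a permutation $\sigma$ of length $n$ if $\{\sigma_i,\dots,\sigma_j\}$ is a set of consecutive integers. $\sigma$ is simple if its only intervals have length $1$ or $n$ (so $1$, $12$, $21$ are simple). For a set $A$ of permutations, $\operatorname{Si}(A)$ is the set of simple permutations in $A$. $\operatorname{Av}(T)$ is the set of permutations avoiding every pattern in $T$. -}

module Defs where

open import Data.Nat using (ℕ; _+_; _∸_; _<_; _≤_)
open import Data.Fin using (Fin; toℕ)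
open import Data.List using (List; []; _∷_; length; lookup)
open import Data.List.Relation.Unary.All using (All)
open import Data.Product using (Σ; ∃; _×_)
open import Data.Sum using (_⊎_)
open import Relation.Nullary using (¬_)
open import Relation.Binary.PropositionalEquality using (_≡_)
open import Function.Definitions using (Injective)
open import Function.Bundles using (_⇔_)

-- A permutation of length n: an injective (hence bijective) map [n] → [n],
-- σ i = value at position i (0-based positions and values).
record Perm (n : ℕ) : Set where
  constructor perm
  field
    σ   : Fin n → Fin n
    inj : Injective _≡_ _≡_ σ
open Perm public

val : ∀ {n} → Perm n → Fin n → ℕ
val π i = toℕ (σ π i)

IsInterval : ∀ {n} → Perm n → Fin n → Fin n → Set
IsInterval {n} π i j =
  ∀ (k l : Fin n) (v : ℕ) →
    toℕ i ≤ toℕ k → toℕ k ≤ toℕ j →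
    toℕ i ≤ toℕ l → toℕ l ≤ toℕ j →
    val π k ≤ v → v ≤ val π l →
    Σ (Fin n) λ m → toℕ i ≤ toℕ m × toℕ m ≤ toℕ j × val π m ≡ v

Simple : ∀ {n} → Perm n → Set
Simple {n} π =
  ∀ (i j : Fin n) → toℕ i ≤ toℕ j → IsInterval π i j →
    (toℕ j ∸ toℕ i + 1 ≡ 1) ⊎ (toℕ j ∸ toℕ i + 1 ≡ n)

-- A pattern is given in one-line notation as a list of naturals
-- (e.g. 2 ∷ 1 ∷ 4 ∷ 3 ∷ [] for 2143).
-- π contains p: there are positions e 0 < e 1 < … < e (k-1) in π whose values
-- are order-isomorphic to p.
Contains : ∀ {n} → Perm n → List ℕ → Set
Contains {n} π p =
  Σ (Fin (length p) → Fin n) λ e →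
    (∀ a b → toℕ a < toℕ b → toℕ (e a) < toℕ (e b)) ×
    (∀ a b → (val π (e a) < val π (e b)) ⇔ (lookup p a < lookup p b))

Avoids : ∀ {n} → Perm n → List (List ℕ) → Set
Avoids π T = All (λ p → ¬ Contains π p) T

InSiAv : List (List ℕ) → ∀ {n} → Perm n → Set
InSiAv T π = Simple π × Avoids π T

-- Every occurrence of 263514 contains 4132 (at the positions of 6, 3, 5, 4), which gives one
-- inclusion. Conversely, let π be simple and avoid 2143, 3142 and 263514, and suppose it
-- contains 4132. Choose an occurrence a < b < c < d whose d is rightmost and, among those,
-- whose b has the smallest value. Then the block of positions b … d is an interval: a position
-- m outside it whose value lies between two values of the block produces either an occurrence
-- of 4132 further to the right or with a smaller value at b, or one of 2143, 3142, 263514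
-- (the last when m lies left of a and below b). As a < b < d, this interval is proper,
-- contradicting simplicity.
module Submission where

open import Defs
open import Data.Nat using (ℕ; zero; suc; _+_; _∸_; _*_; _<_; _≤_; z≤n; z<s; s<s)
open import Data.Nat.Properties
open import Data.Nat.Induction using (<-wellFounded)
open import Induction.WellFounded using (Acc; acc)
open import Data.Fin as Fin using (Fin; toℕ; fromℕ<; punchOut)
open import Data.Fin.Patterns using (0F; 1F; 2F; 3F; 4F; 5F)
import Data.Fin.Properties as Finₚ
open import Data.List using (List; []; _∷_; length; lookup)
open import Data.List.Relation.Unary.All using ([]; _∷_)
open import Data.Vec as Vec using ([]; _∷_)
open import Data.Product using (∃; _×_; _,_; proj₁; proj₂)
open import Data.Sum using (inj₁; inj₂)
open import Data.Unit using (⊤; tt)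
open import Data.Empty using (⊥; ⊥-elim)
open import Relation.Nullary using (¬_; Dec; yes; no)
open import Relation.Nullary.Decidable using (True; toWitness; _×-dec_)
open import Relation.Binary.Core using (_Preserves_⟶_)
open import Relation.Binary.Definitions using (Tri; tri<; tri≈; tri>)
open import Relation.Binary.PropositionalEquality using (_≡_; _≢_; refl; sym; cong; subst)
open import Function.Base using (_∘_)
open import Function.Definitions using (Injective)
open import Function.Bundles using (_⇔_; mk⇔; Equivalence)

injective⇒surjective : ∀ {n} (f : Fin n → Fin n) → Injective _≡_ _≡_ f →
                       ∀ y → ∃ λ x → f x ≡ y
injective⇒surjective {zero} f f-inj ()
injective⇒surjective {suc n} f f-inj y with Finₚ.any? (λ x → f x Finₚ.≟ y)
... | yes hit = hit
... | no miss = ⊥-elim (<-irrefl refl (Finₚ.injective⇒≤ g-inj))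
  where
  y≢f : ∀ x → y ≢ f x
  y≢f x y≡fx = miss (x , sym y≡fx)
  g : Fin (suc n) → Fin n
  g x = punchOut (y≢f x)
  g-inj : Injective _≡_ _≡_ g
  g-inj {x} {x′} eq = f-inj (Finₚ.punchOut-injective (y≢f x) (y≢f x′) eq)

module _ {n} (π : Perm n) where

  val-injective : ∀ {x y} → val π x ≡ val π y → x ≡ y
  val-injective = inj π ∘ Finₚ.toℕ-injective

  val-surjective : ∀ {v} → v < n → ∃ λ x → val π x ≡ v
  val-surjective v<n with x , σx≡v ← injective⇒surjective (σ π) (inj π) (fromℕ< v<n) =
    x , subst (λ y → toℕ y ≡ _) (sym σx≡v) (Finₚ.toℕ-fromℕ< v<n)

  val-cmp : ∀ x y → Tri (val π x < val π y) (x ≡ y) (val π y < val π x)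
  val-cmp x y with Finₚ.<-cmp (σ π x) (σ π y)
  ... | tri< lt ¬eq ¬gt = tri< lt (¬eq ∘ cong (σ π)) ¬gt
  ... | tri≈ ¬lt eq ¬gt = tri≈ ¬lt (inj π eq) ¬gt
  ... | tri> ¬lt ¬eq gt = tri> ¬lt (¬eq ∘ cong (σ π)) gt

IncreasingSteps : ∀ {m} → (Fin m → ℕ) → Set
IncreasingSteps {zero}        f = ⊤
IncreasingSteps {suc zero}    f = ⊤
IncreasingSteps {suc (suc m)} f = f 0F < f 1F × IncreasingSteps (f ∘ Fin.suc)

increasingSteps? : ∀ {m} (f : Fin m → ℕ) → Dec (IncreasingSteps f)
increasingSteps? {zero}        f = yes tt
increasingSteps? {suc zero}    f = yes tt
increasingSteps? {suc (suc m)} f = (f 0F <? f 1F) ×-dec increasingSteps? (f ∘ Fin.suc)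

increasingSteps⇒increasing : ∀ {m} (f : Fin m → ℕ) → IncreasingSteps f →
                             f Preserves Fin._<_ ⟶ _<_
increasingSteps⇒increasing {suc (suc m)} f (f0<f1 , _) {0F} {1F} _ = f0<f1
increasingSteps⇒increasing {suc (suc m)} f (f0<f1 , steps) {0F} {Fin.suc (Fin.suc j)} _ =
  <-trans f0<f1 (increasingSteps⇒increasing (f ∘ Fin.suc) steps {0F} {Fin.suc j} z<s)
increasingSteps⇒increasing {suc (suc m)} f (_ , steps) {Fin.suc i} {Fin.suc j} (s<s i<j) =
  increasingSteps⇒increasing (f ∘ Fin.suc) steps i<j

surjective? : ∀ {m} (r : Fin m → Fin m) → Dec (∀ a → ∃ λ i → r i ≡ a)
surjective? r = Finₚ.all? λ a → Finₚ.any? λ i → r i Finₚ.≟ a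

sorted-alike⇒order-iso : ∀ {m} (f g : Fin m → ℕ) (r : Fin m → Fin m) →
                         (∀ a → ∃ λ i → r i ≡ a) →
                         (f ∘ r) Preserves Fin._<_ ⟶ _<_ → (g ∘ r) Preserves Fin._<_ ⟶ _<_ →
                         ∀ a b → f a < f b ⇔ g a < g b
sorted-alike⇒order-iso f g r r-onto fr↑ gr↑ a b
  with i , refl ← r-onto a | j , refl ← r-onto b | Finₚ.<-cmp i j
... | tri< i<j _ _ = mk⇔ (λ _ → gr↑ i<j) (λ _ → fr↑ i<j)
... | tri≈ _ refl _ = mk⇔ (⊥-elim ∘ <-irrefl refl) (⊥-elim ∘ <-irrefl refl)
... | tri> _ _ j<i = mk⇔ (λ lt → ⊥-elim (<-asym lt (fr↑ j<i)))
                         (λ lt → ⊥-elim (<-asym lt (gr↑ j<i)))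

-- r lists the positions of p in increasing order of value, so that an occurrence e of p is
-- specified by two chains of adjacent strict inequalities: positions in the order of p, values
-- in the order r.
contains-by-sorting : ∀ {n} (π : Perm n) (p : List ℕ) (r : Fin (length p) → Fin (length p)) →
                      {True (surjective? r)} → {True (increasingSteps? (lookup p ∘ r))} →
                      (e : Fin (length p) → Fin n) →
                      IncreasingSteps (toℕ ∘ e) → IncreasingSteps (val π ∘ e ∘ r) →
                      Contains π p
contains-by-sorting π p r {r-onto} {p-sorted} e e↑ ve↑ =
  e , (λ _ _ → increasingSteps⇒increasing (toℕ ∘ e) e↑) ,
  sorted-alike⇒order-iso (val π ∘ e) (lookup p) r (toWitness r-onto)
    (increasingSteps⇒increasing _ ve↑) (increasingSteps⇒increasing _ (toWitness p-sorted))

module Occurrence {n} (π : Perm n) (p : List ℕ) (occurrence : Contains π p) where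

  e : Fin (length p) → Fin n
  e = proj₁ occurrence

  position-< : ∀ i j → {True (toℕ i <? toℕ j)} → toℕ (e i) < toℕ (e j)
  position-< i j {i<j} = proj₁ (proj₂ occurrence) i j (toWitness i<j)

  value-< : ∀ i j → {True (lookup p i <? lookup p j)} → val π (e i) < val π (e j)
  value-< i j {pi<pj} = Equivalence.from (proj₂ (proj₂ occurrence) i j) (toWitness pi<pj)

module _ {n} (π : Perm n) (x₀ x₁ x₂ x₃ : Fin n)
         (x₀<x₁ : toℕ x₀ < toℕ x₁) (x₁<x₂ : toℕ x₁ < toℕ x₂) (x₂<x₃ : toℕ x₂ < toℕ x₃) where

  contains-2143 : val π x₁ < val π x₀ → val π x₀ < val π x₃ → val π x₃ < val π x₂ →
                  Contains π (2 ∷ 1 ∷ 4 ∷ 3 ∷ [])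
  contains-2143 v₁<v₀ v₀<v₃ v₃<v₂ =
    contains-by-sorting π _ (Vec.lookup (1F ∷ 0F ∷ 3F ∷ 2F ∷ []))
      (Vec.lookup (x₀ ∷ x₁ ∷ x₂ ∷ x₃ ∷ [])) (x₀<x₁ , x₁<x₂ , x₂<x₃ , _) (v₁<v₀ , v₀<v₃ , v₃<v₂ , _)

  contains-3142 : val π x₁ < val π x₃ → val π x₃ < val π x₀ → val π x₀ < val π x₂ →
                  Contains π (3 ∷ 1 ∷ 4 ∷ 2 ∷ [])
  contains-3142 v₁<v₃ v₃<v₀ v₀<v₂ =
    contains-by-sorting π _ (Vec.lookup (1F ∷ 3F ∷ 0F ∷ 2F ∷ []))
      (Vec.lookup (x₀ ∷ x₁ ∷ x₂ ∷ x₃ ∷ [])) (x₀<x₁ , x₁<x₂ , x₂<x₃ , _) (v₁<v₃ , v₃<v₀ , v₀<v₂ , _)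

  contains-4132 : val π x₁ < val π x₃ → val π x₃ < val π x₂ → val π x₂ < val π x₀ →
                  Contains π (4 ∷ 1 ∷ 3 ∷ 2 ∷ [])
  contains-4132 v₁<v₃ v₃<v₂ v₂<v₀ =
    contains-by-sorting π _ (Vec.lookup (1F ∷ 3F ∷ 2F ∷ 0F ∷ []))
      (Vec.lookup (x₀ ∷ x₁ ∷ x₂ ∷ x₃ ∷ [])) (x₀<x₁ , x₁<x₂ , x₂<x₃ , _) (v₁<v₃ , v₃<v₂ , v₂<v₀ , _)

contains-263514 : ∀ {n} (π : Perm n) (x₀ x₁ x₂ x₃ x₄ x₅ : Fin n) →
                  toℕ x₀ < toℕ x₁ → toℕ x₁ < toℕ x₂ → toℕ x₂ < toℕ x₃ →
                  toℕ x₃ < toℕ x₄ → toℕ x₄ < toℕ x₅ →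
                  val π x₄ < val π x₀ → val π x₀ < val π x₂ → val π x₂ < val π x₅ →
                  val π x₅ < val π x₃ → val π x₃ < val π x₁ →
                  Contains π (2 ∷ 6 ∷ 3 ∷ 5 ∷ 1 ∷ 4 ∷ [])
contains-263514 π x₀ x₁ x₂ x₃ x₄ x₅ x₀<x₁ x₁<x₂ x₂<x₃ x₃<x₄ x₄<x₅ v₄<v₀ v₀<v₂ v₂<v₅ v₅<v₃ v₃<v₁ =
  contains-by-sorting π _ (Vec.lookup (4F ∷ 0F ∷ 2F ∷ 5F ∷ 3F ∷ 1F ∷ []))
    (Vec.lookup (x₀ ∷ x₁ ∷ x₂ ∷ x₃ ∷ x₄ ∷ x₅ ∷ []))
    (x₀<x₁ , x₁<x₂ , x₂<x₃ , x₃<x₄ , x₄<x₅ , _) (v₄<v₀ , v₀<v₂ , v₂<v₅ , v₅<v₃ , v₃<v₁ , _)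

record Occurrence4132 {n} (π : Perm n) : Set where
  constructor occ
  field
    a b c d : Fin n
    a<b : toℕ a < toℕ b
    b<c : toℕ b < toℕ c
    c<d : toℕ c < toℕ d
    vb<vd : val π b < val π d
    vd<vc : val π d < val π c
    vc<va : val π c < val π a

occurrence4132⇔contains : ∀ {n} (π : Perm n) → Occurrence4132 π ⇔ Contains π (4 ∷ 1 ∷ 3 ∷ 2 ∷ [])
occurrence4132⇔contains π = mk⇔ to from
  where
  to : Occurrence4132 π → Contains π (4 ∷ 1 ∷ 3 ∷ 2 ∷ [])
  to (occ a b c d a<b b<c c<d vb<vd vd<vc vc<va) =
    contains-4132 π a b c d a<b b<c c<d vb<vd vd<vc vc<va
  from : Contains π (4 ∷ 1 ∷ 3 ∷ 2 ∷ []) → Occurrence4132 π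
  from o = occ (e 0F) (e 1F) (e 2F) (e 3F)
    (position-< 0F 1F) (position-< 1F 2F) (position-< 2F 3F)
    (value-< 1F 3F) (value-< 3F 2F) (value-< 2F 0F)
    where open Occurrence π (4 ∷ 1 ∷ 3 ∷ 2 ∷ []) o

contains-263514⇒occurrence4132 : ∀ {n} (π : Perm n) →
                                 Contains π (2 ∷ 6 ∷ 3 ∷ 5 ∷ 1 ∷ 4 ∷ []) → Occurrence4132 π
contains-263514⇒occurrence4132 π o = occ (e 1F) (e 2F) (e 3F) (e 5F)
  (position-< 1F 2F) (position-< 2F 3F) (position-< 3F 5F)
  (value-< 2F 5F) (value-< 5F 3F) (value-< 3F 1F)
  where open Occurrence π (2 ∷ 6 ∷ 3 ∷ 5 ∷ 1 ∷ 4 ∷ []) o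

m∸n+1≤m : ∀ {m n} → 0 < n → n ≤ m → m ∸ n + 1 ≤ m
m∸n+1≤m {m} {n} 0<n n≤m = begin
  m ∸ n + 1 ≤⟨ +-monoˡ-≤ 1 (∸-monoʳ-≤ m 0<n) ⟩
  m ∸ 1 + 1 ≡⟨ m∸n+n≡m (≤-trans 0<n n≤m) ⟩
  m         ∎
  where open ≤-Reasoning

proper-interval⇒¬simple : ∀ {n} (π : Perm n) {i j : Fin n} →
                          0 < toℕ i → toℕ i < toℕ j → IsInterval π i j → ¬ Simple π
proper-interval⇒¬simple π {i} {j} 0<i i<j interval simple with simple i j (<⇒≤ i<j) interval
... | inj₁ length≡1 = <⇒≱ i<j (m∸n≡0⇒m≤n (+-cancelʳ-≡ 1 (toℕ j ∸ toℕ i) 0 length≡1))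
... | inj₂ length≡n = <⇒≱ (Finₚ.toℕ<n j) (subst (_≤ toℕ j) length≡n (m∸n+1≤m 0<i (<⇒≤ i<j)))

later-is-lighter : ∀ {n d d′ x x′} → d < d′ → d′ < n → x′ < n → (n ∸ d′) * n + x′ < (n ∸ d) * n + x
later-is-lighter {n} {d} {d′} {x} {x′} d<d′ d′<n x′<n = begin-strict
  (n ∸ d′) * n + x′ <⟨ +-monoʳ-< ((n ∸ d′) * n) x′<n ⟩
  (n ∸ d′) * n + n  ≡⟨ +-comm ((n ∸ d′) * n) n ⟩
  suc (n ∸ d′) * n  ≤⟨ *-monoˡ-≤ n (∸-monoʳ-< d<d′ (<⇒≤ d′<n)) ⟩
  (n ∸ d) * n       ≤⟨ m≤m+n ((n ∸ d) * n) x ⟩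
  (n ∸ d) * n + x   ∎
  where open ≤-Reasoning

module Avoiding {n} (π : Perm n)
  (avoids-2143 : ¬ Contains π (2 ∷ 1 ∷ 4 ∷ 3 ∷ []))
  (avoids-3142 : ¬ Contains π (3 ∷ 1 ∷ 4 ∷ 2 ∷ []))
  (avoids-263514 : ¬ Contains π (2 ∷ 6 ∷ 3 ∷ 5 ∷ 1 ∷ 4 ∷ [])) where

  private
    V : Fin n → ℕ
    V = val π

  -- Lighter means: d further right, or the same d and a smaller value at b.
  weight : Occurrence4132 π → ℕ
  weight o = (n ∸ toℕ (Occurrence4132.d o)) * n + V (Occurrence4132.b o)

  module Lightest (o : Occurrence4132 π) (lightest : ∀ o′ → weight o′ < weight o → ⊥) where

    open Occurrence4132 o

    Between : Fin n → Set
    Between k = toℕ b ≤ toℕ k × toℕ k ≤ toℕ d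

    b<d : toℕ b < toℕ d
    b<d = <-trans b<c c<d

    vb<vc : V b < V c
    vb<vc = <-trans vb<vd vd<vc

    no-later-occurrence : ∀ o′ → toℕ d < toℕ (Occurrence4132.d o′) → ⊥
    no-later-occurrence o′ d<d′ = lightest o′
      (later-is-lighter d<d′ (Finₚ.toℕ<n (Occurrence4132.d o′))
                             (Finₚ.toℕ<n (σ π (Occurrence4132.b o′))))

    below-b⇒after-c : ∀ k → Between k → V k < V b → toℕ c < toℕ k × toℕ k < toℕ d
    below-b⇒after-c k (b≤k , k≤d) vk<vb with Finₚ.<-cmp k c | Finₚ.<-cmp k d
    ... | tri< k<c _ _ | _ with Finₚ.<-cmp b k
    ...   | tri< b<k _ _ = ⊥-elim (avoids-2143 (contains-2143 π b k c d b<k k<c c<d vk<vb vb<vd vd<vc))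
    ...   | tri≈ _ refl _ = ⊥-elim (<-irrefl refl vk<vb)
    ...   | tri> _ _ k<b = ⊥-elim (<⇒≱ k<b b≤k)
    below-b⇒after-c k _ vk<vb | tri≈ _ refl _ | _ = ⊥-elim (<-asym vk<vb vb<vc)
    below-b⇒after-c k _ _ | tri> _ _ c<k | tri< k<d _ _ = c<k , k<d
    below-b⇒after-c k _ vk<vb | tri> _ _ _ | tri≈ _ refl _ = ⊥-elim (<-asym vk<vb vb<vd)
    below-b⇒after-c k (_ , k≤d) _ | tri> _ _ _ | tri> _ _ d<k = ⊥-elim (<⇒≱ d<k k≤d)

    above-c⇒strictly-between : ∀ l → Between l → V c < V l → toℕ b < toℕ l × toℕ l < toℕ d
    above-c⇒strictly-between l (b≤l , l≤d) vc<vl = ≤∧≢⇒< b≤l b≢l , ≤∧≢⇒< l≤d l≢d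
      where
      b≢l : toℕ b ≢ toℕ l
      b≢l b≡l with refl ← Finₚ.toℕ-injective b≡l = <-asym vb<vc vc<vl
      l≢d : toℕ l ≢ toℕ d
      l≢d l≡d with refl ← Finₚ.toℕ-injective l≡d = <-asym vd<vc vc<vl

    strictly-between⇒below-a : ∀ q → toℕ b < toℕ q → toℕ q < toℕ d → V q < V a
    strictly-between⇒below-a q b<q q<d with val-cmp π q a
    ... | tri< vq<va _ _ = vq<va
    ... | tri≈ _ refl _ = ⊥-elim (<-asym a<b b<q)
    ... | tri> _ _ va<vq with Finₚ.<-cmp q c
    ...   | tri< q<c _ _ = ⊥-elim (avoids-3142 (contains-3142 π a b q c a<b b<q q<c vb<vc vc<va va<vq))
    ...   | tri≈ _ refl _ = ⊥-elim (<-asym vc<va va<vq)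
    ...   | tri> _ _ _ = ⊥-elim (avoids-3142 (contains-3142 π a b q d a<b b<q q<d vb<vd
                                              (<-trans vd<vc vc<va) va<vq))

    no-separator-after : ∀ m k l → toℕ d < toℕ m → Between k → Between l →
                         V k < V m → V m < V l → ⊥
    no-separator-after m k l d<m k∈ l∈ vk<vm vm<vl with val-cmp π m b
    ... | tri< vm<vb _ _ with below-b⇒after-c k k∈ (<-trans vk<vm vm<vb)
    ...   | c<k , k<d = no-later-occurrence
            (occ c k d m c<k k<d d<m vk<vm (<-trans vm<vb vb<vd) vd<vc) d<m
    no-separator-after m k l d<m k∈ l∈ vk<vm vm<vl | tri≈ _ refl _ = <-asym d<m b<d
    no-separator-after m k l d<m k∈ l∈ vk<vm vm<vl | tri> _ _ vb<vm with val-cmp π m c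
    ... | tri< vm<vc _ _ = no-later-occurrence
          (occ a b c m a<b b<c (<-trans c<d d<m) vb<vm vm<vc vc<va) d<m
    ... | tri≈ _ refl _ = <-asym d<m c<d
    ... | tri> _ _ vc<vm with above-c⇒strictly-between l l∈ (<-trans vc<vm vm<vl)
    ...   | b<l , l<d = no-later-occurrence
            (occ a b l m a<b b<l (<-trans l<d d<m) vb<vm vm<vl (strictly-between⇒below-a l b<l l<d)) d<m

    no-separator-before : ∀ m k l → toℕ m < toℕ b → Between k → Between l →
                          V k < V m → V m < V l → ⊥
    no-separator-before m k l m<b k∈ l∈ vk<vm vm<vl with val-cmp π m b
    ... | tri< vm<vb _ _ with below-b⇒after-c k k∈ (<-trans vk<vm vm<vb) | Finₚ.<-cmp m a
    ...   | c<k , k<d | tri< m<a _ _ = avoids-263514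
            (contains-263514 π m a b c k d m<a a<b b<c c<k k<d vk<vm vm<vb vb<vd vd<vc vc<va)
    ...   | _ | tri≈ _ refl _ = <-asym vm<vb (<-trans vb<vc vc<va)
    ...   | _ | tri> _ _ a<m = lightest
            (occ a m c d a<m (<-trans m<b b<c) c<d (<-trans vm<vb vb<vd) vd<vc vc<va)
            (+-monoʳ-< ((n ∸ toℕ d) * n) vm<vb)
    no-separator-before m k l m<b k∈ l∈ vk<vm vm<vl | tri≈ _ refl _ = <-irrefl refl m<b
    no-separator-before m k l m<b k∈ l∈ vk<vm vm<vl | tri> _ _ vb<vm with val-cmp π m d
    ... | tri< vm<vd _ _ = avoids-2143 (contains-2143 π m b c d m<b b<c c<d vb<vm vm<vd vd<vc)
    ... | tri≈ _ refl _ = <-asym m<b b<d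
    ... | tri> _ _ vd<vm with val-cmp π m c
    ...   | tri< vm<vc _ _ = avoids-3142 (contains-3142 π m b c d m<b b<c c<d vb<vd vd<vm vm<vc)
    ...   | tri≈ _ refl _ = <-asym m<b b<c
    ...   | tri> _ _ vc<vm with above-c⇒strictly-between l l∈ (<-trans vc<vm vm<vl)
    ...     | b<l , l<d = avoids-3142 (contains-3142 π m b l d m<b b<l l<d vb<vd vd<vm vm<vl)

    no-separator : ∀ m k l → ¬ Between m → Between k → Between l → V k ≤ V m → V m ≤ V l → ⊥
    no-separator m k l m∉ k∈ l∈ vk≤vm vm≤vl = on-either-side (toℕ b ≤? toℕ m)
      where
      vk<vm : V k < V m
      vk<vm = ≤∧≢⇒< vk≤vm (λ vk≡vm → m∉ (subst Between (val-injective π vk≡vm) k∈))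
      vm<vl : V m < V l
      vm<vl = ≤∧≢⇒< vm≤vl (λ vm≡vl → m∉ (subst Between (sym (val-injective π vm≡vl)) l∈))
      on-either-side : Dec (toℕ b ≤ toℕ m) → ⊥
      on-either-side (no b≰m) = no-separator-before m k l (≰⇒> b≰m) k∈ l∈ vk<vm vm<vl
      on-either-side (yes b≤m) = no-separator-after m k l (≰⇒> (m∉ ∘ (b≤m ,_))) k∈ l∈ vk<vm vm<vl

    b…d-interval : IsInterval π b d
    b…d-interval k l v b≤k k≤d b≤l l≤d vk≤v v≤vl
      with m , refl ← val-surjective π (≤-<-trans v≤vl (Finₚ.toℕ<n (σ π l)))
      with (toℕ b ≤? toℕ m) ×-dec (toℕ m ≤? toℕ d)
    ... | yes (b≤m , m≤d) = m , b≤m , m≤d , refl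
    ... | no m∉ = ⊥-elim (no-separator m k l m∉ (b≤k , k≤d) (b≤l , l≤d) vk≤v v≤vl)

  simple⇒no-occurrence4132 : Simple π → ¬ Occurrence4132 π
  simple⇒no-occurrence4132 simple o = go o (<-wellFounded (weight o))
    where
    go : ∀ o → Acc _<_ (weight o) → ⊥
    go o (acc lighter) =
      proper-interval⇒¬simple π (≤-<-trans z≤n (Occurrence4132.a<b o)) b<d b…d-interval simple
      where open Lightest o (λ o′ o′<o → go o′ (lighter o′<o))

lemma6 : ∀ (n : ℕ) (π : Perm n) →
    InSiAv ((2 ∷ 1 ∷ 4 ∷ 3 ∷ []) ∷ (3 ∷ 1 ∷ 4 ∷ 2 ∷ []) ∷ (2 ∷ 6 ∷ 3 ∷ 5 ∷ 1 ∷ 4 ∷ []) ∷ []) π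
      ⇔ InSiAv ((2 ∷ 1 ∷ 4 ∷ 3 ∷ []) ∷ (3 ∷ 1 ∷ 4 ∷ 2 ∷ []) ∷ (4 ∷ 1 ∷ 3 ∷ 2 ∷ []) ∷ []) π
lemma6 n π = mk⇔
  (λ { (simple , avoids-2143 ∷ avoids-3142 ∷ avoids-263514 ∷ []) →
       simple , avoids-2143 ∷ avoids-3142 ∷
       (Avoiding.simple⇒no-occurrence4132 π avoids-2143 avoids-3142 avoids-263514 simple
          ∘ Equivalence.from (occurrence4132⇔contains π)) ∷ [] })
  (λ { (simple , avoids-2143 ∷ avoids-3142 ∷ avoids-4132 ∷ []) →
       simple , avoids-2143 ∷ avoids-3142 ∷
       (avoids-4132 ∘ Equivalence.to (occurrence4132⇔contains π) ∘ contains-263514⇒occurrence4132 π)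
       ∷ [] })
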